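{- Let $f:R\to S$ be a bijective homomorphism of separation systems. If $R$ is nested and $S$ is regular, then $R$ and $S$ are tree sets and $f$ is an isomorphism of tree sets.
   Context: A separation system is a poset with an order-reversing involution $^*$ ($\overleftarrow s=\vec s^{\,*}$, $s=\{\vec s,\overleftarrow s\}$). $\vec s$ is small if $\vec s\le\overleftarrow s$; regular = no small elements. $\vec s$ is trivial if $\vec s\le\vec r,\overleftarrow r$ for some $r\ne s$. Nested: any two separations have comparable orientations. A tree set is a nested separation system without trivial elements. A homomorphism commutes with the involution and is order-preserving; an isomorphism (of tree sets, if the systems are tree sets) is a bijection $f$ such that $f$ and $f^{ -1}$ are homomorphisms. -}

module Defs where

open import Level using (Level; _⊔_; suc)
open import Relation.Binary.PropositionalEquality using (_≡_)
open import Relation.Binary.Structures using (IsPartialOrder)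
open import Relation.Nullary using (¬_)
open import Data.Product using (Σ; _×_; ∃)
open import Data.Sum using (_⊎_)
open import Function.Definitions using (Bijective; Inverseᵇ)

record SeparationSystem (a ℓ : Level) : Set (suc (a ⊔ ℓ)) where
  infix 4 _≤_
  infix 10 _*
  field
    Carrier        : Set a
    _≤_            : Carrier → Carrier → Set ℓ
    _*             : Carrier → Carrier
    isPartialOrder : IsPartialOrder _≡_ _≤_
    involutive     : ∀ x → (x *) * ≡ x
    order-reversing : ∀ {x y} → x ≤ y → y * ≤ x *

module _ {a ℓ : Level} (R : SeparationSystem a ℓ) where
  open SeparationSystem R

  Small : Carrier → Set ℓ
  Small s = s ≤ s *

  Regular : Set (a ⊔ ℓ)
  Regular = ∀ s → ¬ Small s

  -- s⃗ is trivial if s⃗ ≤ r⃗ and s⃗ ≤ r⃖ for some separation r ≠ s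
  -- (r ≠ s as unoriented separations: r⃗ ∉ {s⃗, s⃖})
  Trivial : Carrier → Set (a ⊔ ℓ)
  Trivial s = Σ Carrier λ r → ¬ (r ≡ s) × ¬ (r ≡ s *) × s ≤ r × s ≤ r *

  Nested : Set (a ⊔ ℓ)
  Nested = ∀ r s → (r ≤ s ⊎ s ≤ r) ⊎ (r ≤ s * ⊎ s * ≤ r)
                  ⊎ (r * ≤ s ⊎ s ≤ r *) ⊎ (r * ≤ s * ⊎ s * ≤ r *)

  IsTreeSet : Set (a ⊔ ℓ)
  IsTreeSet = Nested × (∀ s → ¬ Trivial s)

module _ {a₁ ℓ₁ a₂ ℓ₂ : Level}
         (R : SeparationSystem a₁ ℓ₁) (S : SeparationSystem a₂ ℓ₂) where
  private
    module R = SeparationSystem R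
    module S = SeparationSystem S

  IsHomomorphism : (R.Carrier → S.Carrier) → Set (a₁ ⊔ ℓ₁ ⊔ a₂ ⊔ ℓ₂)
  IsHomomorphism f = (∀ x → f (x R.*) ≡ (f x) S.*)
                   × (∀ {x y} → x R.≤ y → f x S.≤ f y)

module _ {a₁ ℓ₁ a₂ ℓ₂ : Level}
         (R : SeparationSystem a₁ ℓ₁) (S : SeparationSystem a₂ ℓ₂) where
  private
    module R = SeparationSystem R
    module S = SeparationSystem S

  IsIsomorphism : (R.Carrier → S.Carrier) → Set (a₁ ⊔ ℓ₁ ⊔ a₂ ⊔ ℓ₂)
  IsIsomorphism f =
    Bijective _≡_ _≡_ f × IsHomomorphism R S f
    × Σ (S.Carrier → R.Carrier) λ g → Inverseᵇ _≡_ _≡_ f g × IsHomomorphism S R g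

-- The proof rests on four general facts, established first.
--   * Smallness is preserved by homomorphisms, so regularity of S pulls back
--     to R; and a regular separation system has no trivial elements, since a
--     trivial s⃗ ≤ r⃗, r⃖ is small.  Hence "nested" upgrades to "tree set".
--   * Nestedness is equivalent to a four-case normal form (x ≤ y, y ≤ x,
--     x ≤ y*, y* ≤ x); homomorphisms preserve this normal form, so nestedness
--     is carried along surjective homomorphisms.
--   * An injective homomorphism from a nested into a regular system reflects
--     the order: in the two "wrong" cases of the normal form, f x ≤ f y would
--     make f x or (f y)* small in S.
--   * The inverse of a bijective homomorphism that reflects the order is again
--     a homomorphism.
module Submission where

open import Defs
open import Level using (Level)
open import Relation.Binary.PropositionalEquality
  using (_≡_; refl; sym; cong; subst; subst₂; module ≡-Reasoning)
open import Relation.Binary.Structures using (IsPartialOrder)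
open import Relation.Nullary using (¬_)
open import Data.Product using (_×_; _,_; proj₁; proj₂)
open import Data.Sum using (inj₁; inj₂)
open import Data.Empty using (⊥-elim)
open import Function.Definitions using (Bijective; Injective; Surjective)
open import Function.Bundles using (Inverse; mk⤖)
open import Function.Properties.Bijection using (⤖⇒↔)

module SeparationProperties {a ℓ : Level} (R : SeparationSystem a ℓ) where
  open SeparationSystem R
  open IsPartialOrder isPartialOrder public
    using (antisym) renaming (refl to ≤-refl; trans to ≤-trans)

  *-swapʳ : ∀ {x y} → x ≤ y * → y ≤ x *
  *-swapʳ {x} {y} p = subst (_≤ x *) (involutive y) (order-reversing p)

  *-swapˡ : ∀ {x y} → x * ≤ y → y * ≤ x
  *-swapˡ {x} {y} p = subst (y * ≤_) (involutive x) (order-reversing p)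

  *-cancel : ∀ {x y} → x * ≤ y * → y ≤ x
  *-cancel {x} {y} p = subst₂ _≤_ (involutive y) (involutive x) (order-reversing p)

  below-both⇒small : ∀ {x y} → x ≤ y → x ≤ y * → Small R x
  below-both⇒small p q = ≤-trans p (*-swapʳ q)

  -- Trivial separations are small; so regular systems have none.
  regular⇒no-trivial : Regular R → ∀ s → ¬ Trivial R s
  regular⇒no-trivial regular s (_ , _ , _ , s≤r , s≤r*) =
    regular s (below-both⇒small s≤r s≤r*)

  -- Normal form of nestedness: up to the involution, the eight comparisons
  -- in the definition of Nested reduce to these four.
  data Comparable (x y : Carrier) : Set ℓ where
    x≤y  : x ≤ y → Comparable x y
    y≤x  : y ≤ x → Comparable x y
    x≤y* : x ≤ y * → Comparable x y
    y*≤x : y * ≤ x → Comparable x y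

  nested⇒comparable : Nested R → ∀ x y → Comparable x y
  nested⇒comparable nested x y with nested x y
  ... | inj₁ (inj₁ p)               = x≤y p
  ... | inj₁ (inj₂ p)               = y≤x p
  ... | inj₂ (inj₁ (inj₁ p))        = x≤y* p
  ... | inj₂ (inj₁ (inj₂ p))        = y*≤x p
  ... | inj₂ (inj₂ (inj₁ (inj₁ p))) = y*≤x (*-swapˡ p)
  ... | inj₂ (inj₂ (inj₁ (inj₂ p))) = x≤y* (*-swapʳ p)
  ... | inj₂ (inj₂ (inj₂ (inj₁ p))) = y≤x (*-cancel p)
  ... | inj₂ (inj₂ (inj₂ (inj₂ p))) = x≤y (*-cancel p)

  comparable⇒nested : (∀ x y → Comparable x y) → Nested R
  comparable⇒nested comparable x y with comparable x y
  ... | x≤y p  = inj₁ (inj₁ p)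
  ... | y≤x p  = inj₁ (inj₂ p)
  ... | x≤y* p = inj₂ (inj₁ (inj₁ p))
  ... | y*≤x p = inj₂ (inj₁ (inj₂ p))

module HomomorphismProperties
  {a₁ ℓ₁ a₂ ℓ₂ : Level} {R : SeparationSystem a₁ ℓ₁} {S : SeparationSystem a₂ ℓ₂}
  {f : SeparationSystem.Carrier R → SeparationSystem.Carrier S}
  (hom : IsHomomorphism R S f) where
  private
    module R = SeparationSystem R
    module S = SeparationSystem S
    module PR = SeparationProperties R
    module PS = SeparationProperties S

  f-* : ∀ x → f (x R.*) ≡ (f x) S.*
  f-* = proj₁ hom

  f-≤ : ∀ {x y} → x R.≤ y → f x S.≤ f y
  f-≤ = proj₂ hom

  f-≤* : ∀ {x y} → x R.≤ y R.* → f x S.≤ (f y) S.*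
  f-≤* {x} {y} p = subst (f x S.≤_) (f-* y) (f-≤ p)

  f-*≤ : ∀ {x y} → y R.* R.≤ x → (f y) S.* S.≤ f x
  f-*≤ {x} {y} p = subst (S._≤ f x) (f-* y) (f-≤ p)

  -- Homomorphisms preserve smallness, hence reflect regularity.
  regular-reflect : Regular S → Regular R
  regular-reflect regular x small = regular (f x) (f-≤* small)

  comparable-image : ∀ {x y} → PR.Comparable x y → PS.Comparable (f x) (f y)
  comparable-image (PR.x≤y p)  = PS.x≤y (f-≤ p)
  comparable-image (PR.y≤x p)  = PS.y≤x (f-≤ p)
  comparable-image (PR.x≤y* p) = PS.x≤y* (f-≤* p)
  comparable-image (PR.y*≤x p) = PS.y*≤x (f-*≤ p)

  nested-image : Surjective _≡_ _≡_ f → Nested R → Nested S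
  nested-image surjective nested = PS.comparable⇒nested comparable
    where
    comparable : ∀ a b → PS.Comparable a b
    comparable a b with surjective a | surjective b
    ... | x , fx≡a | y , fy≡b =
      subst₂ PS.Comparable (fx≡a refl) (fy≡b refl)
        (comparable-image (PR.nested⇒comparable nested x y))

  -- Injective homomorphisms from nested into regular systems reflect the order:
  -- the cases y ≤ x, x ≤ y*, y* ≤ x of the normal form force x ≡ y, or make
  -- f x, resp. (f y)*, small.
  order-reflect : Injective _≡_ _≡_ f → Nested R → Regular S
                → ∀ {x y} → f x S.≤ f y → x R.≤ y
  order-reflect injective nested regular {x} {y} fx≤fy
    with PR.nested⇒comparable nested x y
  ... | PR.x≤y p  = p
  ... | PR.y≤x p  = subst (x R.≤_) (injective (PS.antisym fx≤fy (f-≤ p))) PR.≤-refl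
  ... | PR.x≤y* p = ⊥-elim (regular (f x) (PS.below-both⇒small fx≤fy (f-≤* p)))
  ... | PR.y*≤x p = ⊥-elim (regular ((f y) S.*)
                      (PS.below-both⇒small (PS.≤-trans (f-*≤ p) fx≤fy) PS.≤-refl))

  inverse-homomorphism : (g : S.Carrier → R.Carrier)
    → (∀ a → f (g a) ≡ a) → (∀ x → g (f x) ≡ x)
    → (∀ {x y} → f x S.≤ f y → x R.≤ y)
    → IsHomomorphism S R g
  inverse-homomorphism g fg≡id gf≡id reflect = g-* , g-≤
    where
    open ≡-Reasoning

    g-* : ∀ a → g (a S.*) ≡ (g a) R.*
    g-* a = begin
      g (a S.*)             ≡⟨ cong (λ b → g (b S.*)) (sym (fg≡id a)) ⟩
      g ((f (g a)) S.*)     ≡⟨ cong g (sym (f-* (g a))) ⟩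
      g (f ((g a) R.*))     ≡⟨ gf≡id ((g a) R.*) ⟩
      (g a) R.*             ∎

    g-≤ : ∀ {a b} → a S.≤ b → g a R.≤ g b
    g-≤ {a} {b} a≤b = reflect (subst₂ S._≤_ (sym (fg≡id a)) (sym (fg≡id b)) a≤b)

lemma2p6 : {a₁ ℓ₁ a₂ ℓ₂ : Level} (R : SeparationSystem a₁ ℓ₁) (S : SeparationSystem a₂ ℓ₂)
    (f : SeparationSystem.Carrier R → SeparationSystem.Carrier S)
    → IsHomomorphism R S f → Bijective _≡_ _≡_ f
    → Nested R → Regular S
    → IsTreeSet R × IsTreeSet S × IsIsomorphism R S f
lemma2p6 R S f hom bij@(injective , surjective) nestedR regularS =
    (nestedR , SeparationProperties.regular⇒no-trivial R regularR)
  , (nestedS , SeparationProperties.regular⇒no-trivial S regularS)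
  , bij , hom , from , inverse , homFrom
  where
  open HomomorphismProperties {R = R} {S = S} {f = f} hom
  open Inverse (⤖⇒↔ (mk⤖ bij)) using (from; inverse; strictlyInverseˡ; strictlyInverseʳ)

  regularR : Regular R
  regularR = regular-reflect regularS

  nestedS : Nested S
  nestedS = nested-image surjective nestedR

  homFrom : IsHomomorphism S R from
  homFrom = inverse-homomorphism from strictlyInverseˡ strictlyInverseʳ
              (order-reflect injective nestedR regularS)
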